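{- Let $G$ be a signed digraph. If each strong component of $G$ is perfectly fixing, then $G$ is perfectly fixing.
   Context: A signed digraph $G=(V,E)$ has finite vertex set $V$ and arcs $E\subseteq V\times V\times\{ -1,1\}$. A subgraph of $G$ is $(V',E')$ with $V'\subseteq V$, $E'\subseteq E\cap(V'\times V'\times\{ -1,1\})$. A strong component is an induced subgraph that is strongly connected (in the underlying digraph) and maximal with this property. A BN on $W$ is $f:\{0,1\}^W\to\{0,1\}^W$; $G(f)$ has a positive (negative) arc from $j$ to $i$ iff for some $x$ with $x_j=0$, $f_i(x+e_j)-f_i(x)$ is positive (negative) ($e_j$ = configuration equal to $1$ only at $j$, $+$ mod 2); $F(H)=\{f:G(f)=H\}$. $\Gamma(f)$ is the digraph on $\{0,1\}^W$ with arcs $x\to x+e_i$ whenever $f_i(x)\neq x_i$; an attractor is an inclusion-minimal nonempty set of configurations with no outgoing arc. A signed digraph $H$ is fixing if for every $f\in F(H)$ all attractors of $\Gamma(f)$ have size one, and perfectly fixing if every subgraph of $H$ is fixing. -}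

module Defs where

open import Data.Nat using (ℕ)
open import Data.Fin using (Fin)
open import Data.Bool using (Bool; true; false; not)
open import Data.Vec using (Vec; lookup; updateAt)
open import Data.Product using (Σ; ∃; _×_; _,_)
open import Relation.Binary.PropositionalEquality using (_≡_; _≢_)
open import Function.Definitions using (Injective)

data Sign : Set where
  pos neg : Sign

-- A signed digraph on the vertex set Fin m: the arc relation
-- E j i s  means  (j , i , s) ∈ E, i.e. an arc from j to i with sign s.
SDigraph : ℕ → Set₁
SDigraph m = Fin m → Fin m → Sign → Set

-- Configurations {0,1}^m (false = 0, true = 1) and Boolean networks.
Config : ℕ → Set
Config m = Vec Bool m

BN : ℕ → Set
BN m = Config m → Config m

flipAt : ∀ {m} → Config m → Fin m → Config m
flipAt x j = updateAt x j not

-- f_i(x + e_j) - f_i(x) has sign s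
Diff : ∀ {m} → BN m → Fin m → Fin m → Config m → Sign → Set
Diff f j i x pos = (lookup (f x) i ≡ false) × (lookup (f (flipAt x j)) i ≡ true)
Diff f j i x neg = (lookup (f x) i ≡ true) × (lookup (f (flipAt x j)) i ≡ false)

GArc : ∀ {m} → BN m → SDigraph m
GArc f j i s = ∃ λ x → (lookup x j ≡ false) × Diff f j i x s

InF : ∀ {m} → SDigraph m → BN m → Set
InF H f = ∀ j i s → (H j i s → GArc f j i s) × (GArc f j i s → H j i s)

Trans : ∀ {m} → BN m → Config m → Config m → Set
Trans f x y = ∃ λ i → (lookup (f x) i ≢ lookup x i) × (y ≡ flipAt x i)

CSet : ℕ → Set₁
CSet m = Config m → Set

_⊆ᶜ_ : ∀ {m} → CSet m → CSet m → Set
A ⊆ᶜ B = ∀ x → A x → B x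

NonEmpty : ∀ {m} → CSet m → Set
NonEmpty A = ∃ λ x → A x

Trap : ∀ {m} → BN m → CSet m → Set
Trap f A = ∀ x y → A x → Trans f x y → A y

Attractor : ∀ {m} → BN m → CSet m → Set₁
Attractor f A = NonEmpty A × Trap f A ×
  (∀ B → B ⊆ᶜ A → NonEmpty B → Trap f B → A ⊆ᶜ B)

SizeOne : ∀ {m} → CSet m → Set
SizeOne A = ∃ λ x → A x × (∀ y → A y → y ≡ x)

Fixing : ∀ {m} → SDigraph m → Set₁
Fixing {m} H = ∀ (f : BN m) → InF H f → ∀ (A : CSet m) → Attractor f A → SizeOne A

-- H (on Fin k) is (an isomorphic copy of) a subgraph of G, via the injective
-- vertex map ι: every arc of H is an arc of G between the images.
SubgraphVia : ∀ {k m} → SDigraph k → SDigraph m → (Fin k → Fin m) → Set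
SubgraphVia {k} {m} H G ι =
  Injective _≡_ _≡_ ι × (∀ a b s → H a b s → G (ι a) (ι b) s)

PerfectlyFixing : ∀ {m} → SDigraph m → Set₁
PerfectlyFixing {m} G =
  ∀ (k : ℕ) (H : SDigraph k) (ι : Fin k → Fin m) → SubgraphVia H G ι → Fixing H

VSet : ℕ → Set₁
VSet m = Fin m → Set

UArc : ∀ {m} → SDigraph m → Fin m → Fin m → Set
UArc G u v = ∃ λ s → G u v s

data PathIn {m} (G : SDigraph m) (S : VSet m) : Fin m → Fin m → Set where
  here : ∀ {u} → S u → PathIn G S u u
  step : ∀ {u w v} → S u → UArc G u w → PathIn G S w v → PathIn G S u v

StronglyConnected : ∀ {m} → SDigraph m → VSet m → Set
StronglyConnected G S = ∀ u v → S u → S v → PathIn G S u v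

StrongComponent : ∀ {m} → SDigraph m → VSet m → Set₁
StrongComponent {m} G S = StronglyConnected G S ×
  (∀ (T : VSet m) → (∀ v → S v → T v) → StronglyConnected G T → ∀ v → T v → S v)

Induced : ∀ {k m} → SDigraph m → (Fin k → Fin m) → SDigraph k
Induced G ι a b s = G (ι a) (ι b) s

Enumerates : ∀ {k m} → (Fin k → Fin m) → VSet m → Set
Enumerates {k} {m} ι S = Injective _≡_ _≡_ ι × (∀ v → (S v → ∃ λ a → ι a ≡ v) × (∃ (λ a → ι a ≡ v) → S v))

{-# OPTIONS --safe #-}
-- Suppose some vertex varies on an attractor A of f ∈ F(H), H ⊆ G.  Reasoning classically, pick
-- such a vertex i minimal for reachability in G among the varying vertices, and let T be its
-- strong component.  Every vertex outside T with an arc of G(f) into T is then constant on A.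
-- So restricting f to the vertices in T, with all other vertices frozen at a point of A, gives a
-- network whose interaction graph is a subgraph of G[T] and onto which A projects as an
-- attractor.  As G[T] is perfectly fixing, that attractor is a point, contradicting that i varies.
module Submission where

open import Defs
open import Level using (0ℓ)
open import Data.Nat using (ℕ)
open import Data.Nat.Induction using (<-wellFounded)
open import Data.Fin using (Fin; zero; suc) renaming (_≟_ to _≟ᶠ_)
open import Data.Fin.Properties using (any?; sequence)
import Data.Fin.Subset as Subset
open import Data.Fin.Subset.Properties using (p⊂q⇒∣p∣<∣q∣)
open import Data.Bool using (Bool; true; false; not)
open import Data.Bool.Properties using (¬-not; not-involutive) renaming (_≟_ to _≟ᵇ_)
open import Data.Vec using (lookup; tabulate)
open import Data.Vec.Properties
  using ( lookup∘updateAt; lookup∘updateAt′; lookup∘tabulate; tabulate∘lookup; tabulate-cong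
        ; ≡-dec; []=⇒lookup; lookup⇒[]=)
open import Data.List using (List; []; _∷_; allFin; filter; length)
import Data.List as List
open import Data.List.Membership.Propositional using (_∈_)
open import Data.List.Membership.Propositional.Properties using (∈-allFin; ∈-filter⁺; ∈-filter⁻; ∈-lookup)
import Data.List.Relation.Unary.All as All
open import Data.List.Relation.Unary.AllPairs using (_∷_)
import Data.List.Relation.Unary.Any as Any
open import Data.List.Relation.Unary.Any.Properties using (¬Any[]; lookup-index)
open import Data.List.Relation.Unary.Unique.Propositional using (Unique)
open import Data.List.Relation.Unary.Unique.Propositional.Properties using (allFin⁺; filter⁺)
open import Data.Product using (∃; _×_; _,_; proj₁; proj₂)
open import Data.Sum using (_⊎_; inj₁; inj₂)
open import Data.Unit using (⊤; tt)
open import Data.Empty using (⊥; ⊥-elim)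
open import Effect.Monad using (RawMonad)
open import Function using (_∘_; id)
open import Function.Definitions using (Injective)
open import Induction.WellFounded using (WellFounded; Acc; acc; module Subrelation)
open import Relation.Binary using (Rel; Reflexive; Transitive)
import Relation.Binary.Construct.On as On
open import Relation.Binary.Construct.Closure.ReflexiveTransitive using (Star; ε; _◅_; _◅◅_)
open import Relation.Binary.PropositionalEquality
open import Relation.Nullary using (¬_; Dec; yes; no; does)
open import Relation.Nullary.Decidable
  using (_×-dec_; ¬?; decidable-stable; dec-true; dec-false; ¬¬-excluded-middle)
open import Relation.Nullary.Negation using (¬¬-Monad)
open import Relation.Unary using (Pred; Decidable)

lookup-ext : ∀ {n} {x y : Config n} → (∀ a → lookup x a ≡ lookup y a) → x ≡ y
lookup-ext {x = x} {y} h = begin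
  x                   ≡⟨ tabulate∘lookup x ⟨
  tabulate (lookup x) ≡⟨ tabulate-cong h ⟩
  tabulate (lookup y) ≡⟨ tabulate∘lookup y ⟩
  y                   ∎
  where open ≡-Reasoning

flipAt-same : ∀ {n} (x : Config n) j → lookup (flipAt x j) j ≡ not (lookup x j)
flipAt-same x j = lookup∘updateAt j x

flipAt-other : ∀ {n} (x : Config n) {i} j → i ≢ j → lookup (flipAt x j) i ≡ lookup x i
flipAt-other x {i} j i≢j = lookup∘updateAt′ i j i≢j x

flipAt-involutive : ∀ {n} (x : Config n) j → flipAt (flipAt x j) j ≡ x
flipAt-involutive x j = lookup-ext pointwise
  where
  pointwise : ∀ i → lookup (flipAt (flipAt x j) j) i ≡ lookup x i
  pointwise i with i ≟ᶠ j
  ... | yes refl = trans (flipAt-same (flipAt x i) i) (trans (cong not (flipAt-same x i)) (not-involutive _))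
  ... | no i≢j = trans (flipAt-other (flipAt x j) j i≢j) (flipAt-other x j i≢j)

Diff-transport : ∀ {k n} {f : BN k} {g : BN n} {j i x j′ i′ y} s →
  lookup (f x) i ≡ lookup (g y) i′ →
  lookup (f (flipAt x j)) i ≡ lookup (g (flipAt y j′)) i′ →
  Diff f j i x s → Diff g j′ i′ y s
Diff-transport pos p q (fx , fx′) = trans (sym p) fx , trans (sym q) fx′
Diff-transport neg p q (fx , fx′) = trans (sym p) fx , trans (sym q) fx′

NoArc : ∀ {k} → BN k → Fin k → Fin k → Set
NoArc f j i = ∀ s → ¬ GArc f j i s

Differ : ∀ {k} → Config k → Config k → Fin k → Set
Differ x y a = lookup x a ≢ lookup y a

module _ {k} (f : BN k) where

  Diff-from-≢ : ∀ {j i} x → lookup (f x) i ≢ lookup (f (flipAt x j)) i → ∃ (Diff f j i x)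
  Diff-from-≢ {j} {i} x changes with lookup (f x) i in p | lookup (f (flipAt x j)) i in q
  ... | false | true = pos , p , q
  ... | true | false = neg , p , q
  ... | false | false = ⊥-elim (changes refl)
  ... | true | true = ⊥-elim (changes refl)

  flipAt-irrelevant₀ : ∀ {j i} → NoArc f j i → ∀ x → lookup x j ≡ false →
    lookup (f (flipAt x j)) i ≡ lookup (f x) i
  flipAt-irrelevant₀ noArc x xj = decidable-stable (_ ≟ᵇ _) λ changes →
    let s , diff = Diff-from-≢ x (changes ∘ sym) in noArc s (x , xj , diff)

  flipAt-irrelevant : ∀ {j i} → NoArc f j i → ∀ x → lookup (f (flipAt x j)) i ≡ lookup (f x) i
  flipAt-irrelevant {j} {i} noArc x with lookup x j in xj
  ... | false = flipAt-irrelevant₀ noArc x xj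
  ... | true = sym (begin
    lookup (f x) i                       ≡⟨ cong (λ w → lookup (f w) i) (flipAt-involutive x j) ⟨
    lookup (f (flipAt (flipAt x j) j)) i ≡⟨ flipAt-irrelevant₀ noArc (flipAt x j) x′j ⟩
    lookup (f (flipAt x j)) i            ∎)
    where
    open ≡-Reasoning
    x′j : lookup (flipAt x j) j ≡ false
    x′j = trans (flipAt-same x j) (cong not xj)

  -- Flip the differing coordinates one at a time; l lists those not yet flipped.
  lookup-cong-covered : ∀ (l : List (Fin k)) {i x y} → (∀ a → Differ x y a → a ∈ l × NoArc f a i) →
    lookup (f x) i ≡ lookup (f y) i
  lookup-cong-covered [] {i} h =
    cong (λ w → lookup (f w) i) (lookup-ext λ a → decidable-stable (_ ≟ᵇ _) (¬Any[] ∘ proj₁ ∘ h a))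
  lookup-cong-covered (j ∷ l) {i} {x} {y} h with lookup x j ≟ᵇ lookup y j
  ... | yes agree = lookup-cong-covered l λ a d →
    Any.tail (λ { refl → d agree }) (proj₁ (h a d)) , proj₂ (h a d)
  ... | no d = trans (sym (flipAt-irrelevant (proj₂ (h j d)) x)) (lookup-cong-covered l h′)
    where
    h′ : ∀ a → Differ (flipAt x j) y a → a ∈ l × NoArc f a i
    h′ a d′ with a ≟ᶠ j
    ... | yes refl = ⊥-elim (d′ (trans (flipAt-same x a) (sym (¬-not (d ∘ sym)))))
    ... | no a≢j = Any.tail a≢j (proj₁ (h a d″)) , proj₂ (h a d″)
      where
      d″ : Differ x y a
      d″ = d′ ∘ trans (flipAt-other x j a≢j)

  lookup-cong-inputs : ∀ {i x y} → (∀ a → Differ x y a → NoArc f a i) → lookup (f x) i ≡ lookup (f y) i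
  lookup-cong-inputs h = lookup-cong-covered (allFin k) λ a d → ∈-allFin a , h a d

Reach : ∀ {k} → BN k → Config k → Config k → Set
Reach f = Star (Trans f)

attractor-reach : ∀ {k} {f : BN k} {A : CSet k} → Attractor f A → ∀ {x y} → A x → A y → Reach f x y
attractor-reach {f = f} {A} (_ , trap , minimal) {x} x∈A y∈A =
  proj₂ (minimal reachable (λ _ → proj₁) (x , x∈A , ε) reachable-trap _ y∈A)
  where
  reachable : CSet _
  reachable w = A w × Reach f x w
  reachable-trap : Trap f reachable
  reachable-trap w w′ (w∈A , x⇝w) t = trap w w′ w∈A t , x⇝w ◅◅ (t ◅ ε)

-- f restricted to the image of e, the coordinates outside the image being held at x₀.
module Restriction
  {k p} (f : BN k) (x₀ : Config k) (e : Fin p → Fin k) (e-injective : Injective _≡_ _≡_ e) where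

  InImage : Fin k → Set
  InImage a = ∃ λ q → e q ≡ a

  inImage? : ∀ a → Dec (InImage a)
  inImage? a = any? λ q → e q ≟ᶠ a

  project : Config k → Config p
  project y = tabulate (lookup y ∘ e)

  fill : Config p → ∀ a → Dec (InImage a) → Bool
  fill z a (yes (q , _)) = lookup z q
  fill z a (no _) = lookup x₀ a

  extend : Config p → Config k
  extend z = tabulate λ a → fill z a (inImage? a)

  restrict : BN p
  restrict = project ∘ f ∘ extend

  lookup-project : ∀ y q → lookup (project y) q ≡ lookup y (e q)
  lookup-project y q = lookup∘tabulate _ q

  lookup-restrict : ∀ z q → lookup (restrict z) q ≡ lookup (f (extend z)) (e q)
  lookup-restrict z q = lookup-project (f (extend z)) q

  lookup-extend-image : ∀ z q → lookup (extend z) (e q) ≡ lookup z q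
  lookup-extend-image z q = trans (lookup∘tabulate _ (e q)) (fill-image (inImage? (e q)))
    where
    fill-image : (d : Dec (InImage (e q))) → fill z (e q) d ≡ lookup z q
    fill-image (yes (q′ , eq)) = cong (lookup z) (e-injective eq)
    fill-image (no ∉image) = ⊥-elim (∉image (q , refl))

  lookup-extend-outside : ∀ z {a} → ¬ InImage a → lookup (extend z) a ≡ lookup x₀ a
  lookup-extend-outside z {a} ∉image = trans (lookup∘tabulate _ a) (fill-outside (inImage? a))
    where
    fill-outside : (d : Dec (InImage a)) → fill z a d ≡ lookup x₀ a
    fill-outside (yes ∈image) = ⊥-elim (∉image ∈image)
    fill-outside (no _) = refl

  flipAt-along : ∀ {u : Config k} {v : Config p} → (∀ q → lookup u (e q) ≡ lookup v q) →
    ∀ q q′ → lookup (flipAt u (e q)) (e q′) ≡ lookup (flipAt v q) q′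
  flipAt-along {u} {v} u≈v q q′ with q′ ≟ᶠ q
  ... | yes refl = trans (flipAt-same u (e q)) (trans (cong not (u≈v q)) (sym (flipAt-same v q)))
  ... | no q′≢q =
    trans (flipAt-other u (e q) (q′≢q ∘ e-injective)) (trans (u≈v q′) (sym (flipAt-other v q q′≢q)))

  project-flipAt-image : ∀ y q → project (flipAt y (e q)) ≡ flipAt (project y) q
  project-flipAt-image y q = lookup-ext λ q′ →
    trans (lookup-project (flipAt y (e q)) q′) (flipAt-along {y} {project y} (sym ∘ lookup-project y) q q′)

  project-flipAt-outside : ∀ y {a} → ¬ InImage a → project (flipAt y a) ≡ project y
  project-flipAt-outside y {a} ∉image = lookup-ext λ q →
    trans (lookup-project (flipAt y a) q)
      (trans (flipAt-other y a (λ eq → ∉image (q , eq))) (sym (lookup-project y q)))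

  extend-flipAt : ∀ z q → extend (flipAt z q) ≡ flipAt (extend z) (e q)
  extend-flipAt z q = lookup-ext pointwise
    where
    pointwise : ∀ a → lookup (extend (flipAt z q)) a ≡ lookup (flipAt (extend z) (e q)) a
    pointwise a with inImage? a
    ... | yes (q′ , refl) =
      trans (lookup-extend-image (flipAt z q) q′) (sym (flipAt-along {extend z} {z} (lookup-extend-image z) q q′))
    ... | no ∉image =
      trans (lookup-extend-outside (flipAt z q) ∉image)
        (sym (trans (flipAt-other (extend z) (e q) (λ eq → ∉image (q , sym eq)))
               (lookup-extend-outside z ∉image)))

  restrict-arc : ∀ {q q′ s} → GArc restrict q q′ s → GArc f (e q) (e q′) s
  restrict-arc {q} {q′} {s} (z , zq , diff) =
    extend z , trans (lookup-extend-image z q) zq ,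
    Diff-transport s (lookup-restrict z q′)
      (trans (lookup-restrict (flipAt z q) q′) (cong (λ w → lookup (f w) (e q′)) (extend-flipAt z q)))
      diff

  module _ {A : CSet k} (attractor : Attractor f A)
    (frozen : ∀ a q → ¬ InImage a → UArc (GArc f) a (e q) → ∀ y → A y → lookup y a ≡ lookup x₀ a)
    where

    Projected : CSet p
    Projected z = ∃ λ y → A y × z ≡ project y

    A-trap : Trap f A
    A-trap = proj₁ (proj₂ attractor)

    -- On A, extend (project y) differs from y only at frozen coordinates, which are not inputs of e q.
    lookup-restrict-project : ∀ {y} → A y → ∀ q → lookup (restrict (project y)) q ≡ lookup (f y) (e q)
    lookup-restrict-project {y} y∈A q = trans (lookup-restrict (project y) q) (lookup-cong-inputs f noArc)
      where
      noArc : ∀ a → Differ (extend (project y)) y a → NoArc f a (e q)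
      noArc a d s arc with inImage? a
      ... | yes (q′ , refl) = d (trans (lookup-extend-image (project y) q′) (lookup-project y q′))
      ... | no ∉image =
        d (trans (lookup-extend-outside (project y) ∉image) (sym (frozen a q ∉image (s , arc) y y∈A)))

    Trans-lift : ∀ {y z} → A y → Trans restrict (project y) z →
      ∃ λ y′ → Trans f y y′ × z ≡ project y′
    Trans-lift {y} y∈A (q , changes , refl) =
      flipAt y (e q) , (e q , changes′ , refl) , sym (project-flipAt-image y q)
      where
      changes′ : lookup (f y) (e q) ≢ lookup y (e q)
      changes′ eq = changes (trans (lookup-restrict-project y∈A q) (trans eq (sym (lookup-project y q))))

    Trans-project : ∀ {y y′} → A y → Trans f y y′ →
      Trans restrict (project y) (project y′) ⊎ project y′ ≡ project y
    Trans-project {y} y∈A (a , changes , refl) with inImage? a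
    ... | yes (q , refl) = inj₁ (q , changes′ , project-flipAt-image y q)
      where
      changes′ : lookup (restrict (project y)) q ≢ lookup (project y) q
      changes′ eq = changes (trans (sym (lookup-restrict-project y∈A q)) (trans eq (lookup-project y q)))
    ... | no ∉image = inj₂ (project-flipAt-outside y ∉image)

    Projected-trap : Trap restrict Projected
    Projected-trap _ _ (y , y∈A , refl) t =
      let y′ , t′ , z≡ = Trans-lift y∈A t in y′ , A-trap y y′ y∈A t′ , z≡

    Projected-minimal : ∀ B → B ⊆ᶜ Projected → NonEmpty B → Trap restrict B → Projected ⊆ᶜ B
    Projected-minimal B B⊆ (z′ , z′∈B) B-trap _ (y , y∈A , refl) with B⊆ z′ z′∈B
    ... | y′ , y′∈A , refl = follow (attractor-reach {f = f} attractor y′∈A y∈A) y′∈A z′∈B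
      where
      follow : ∀ {w w′} → Reach f w w′ → A w → B (project w) → B (project w′)
      follow ε _ b = b
      follow {w} (t ◅ r) w∈A b with Trans-project w∈A t
      ... | inj₁ t↾ = follow r (A-trap _ _ w∈A t) (B-trap _ _ b t↾)
      ... | inj₂ same = follow r (A-trap _ _ w∈A t) (subst B (sym same) b)

    Projected-attractor : Attractor restrict Projected
    Projected-attractor =
      (let x , x∈A = proj₁ attractor in project x , x , x∈A , refl) , Projected-trap , Projected-minimal

module Minimal {n} {P : Pred (Fin n) 0ℓ} (P? : Decidable P)
  {_≲_ : Rel (Fin n) 0ℓ} (_≲?_ : ∀ i j → Dec (i ≲ j))
  (≲-refl : Reflexive _≲_) (≲-trans : Transitive _≲_) where

  IsMinimal : Fin n → Set
  IsMinimal i = P i × (∀ j → P j → j ≲ i → i ≲ j)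

  _≺_ : Rel (Fin n) 0ℓ
  j ≺ i = P j × j ≲ i × ¬ i ≲ j

  below : Fin n → Subset.Subset n
  below i = tabulate λ j → does (j ≲? i)

  ∈-below⁺ : ∀ {i j} → j ≲ i → j Subset.∈ below i
  ∈-below⁺ {i} {j} j≲i = lookup⇒[]= j (below i) (trans (lookup∘tabulate _ j) (dec-true (j ≲? i) j≲i))

  ∈-below⁻ : ∀ {i j} → j Subset.∈ below i → j ≲ i
  ∈-below⁻ {i} {j} j∈ = decidable-stable (j ≲? i) λ j≴i →
    false≢true (trans (sym (dec-false (j ≲? i) j≴i)) (trans (sym (lookup∘tabulate _ j)) ([]=⇒lookup j∈)))
    where
    false≢true : false ≢ true
    false≢true ()

  ≺⇒below⊂ : ∀ {i j} → j ≺ i → below j Subset.⊂ below i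
  ≺⇒below⊂ {i} (_ , j≲i , i≴j) =
    (λ l∈ → ∈-below⁺ (≲-trans (∈-below⁻ l∈) j≲i)) , i , ∈-below⁺ ≲-refl , i≴j ∘ ∈-below⁻

  ≺-wellFounded : WellFounded _≺_
  ≺-wellFounded = Subrelation.wellFounded (p⊂q⇒∣p∣<∣q∣ ∘ ≺⇒below⊂)
    (On.wellFounded (Subset.∣_∣ ∘ below) <-wellFounded)

  minimal-acc : ∀ {i} → Acc _≺_ i → P i → ∃ IsMinimal
  minimal-acc {i} (acc rs) pi with any? (λ j → P? j ×-dec (j ≲? i) ×-dec ¬? (i ≲? j))
  ... | yes (j , j≺i) = minimal-acc (rs j≺i) (proj₁ j≺i)
  ... | no ∄≺i = i , pi , λ j pj j≲i → decidable-stable (i ≲? j) λ i≴j → ∄≺i (j , pj , j≲i , i≴j)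

  minimal : ∀ {i} → P i → ∃ IsMinimal
  minimal = minimal-acc (≺-wellFounded _)

Path : ∀ {m} → SDigraph m → Fin m → Fin m → Set
Path G = PathIn G (λ _ → ⊤)

module _ {m} {G : SDigraph m} where

  _++ₚ_ : ∀ {S u v w} → PathIn G S u v → PathIn G S v w → PathIn G S u w
  here _ ++ₚ q = q
  step s a p ++ₚ q = step s a (p ++ₚ q)

  PathIn⇒Path : ∀ {S u v} → PathIn G S u v → Path G u v
  PathIn⇒Path (here _) = here tt
  PathIn⇒Path (step _ a p) = step tt a (PathIn⇒Path p)

MutuallyReachable : ∀ {m} → SDigraph m → Fin m → VSet m
MutuallyReachable G r u = Path G r u × Path G u r

mutuallyReachable-strongComponent : ∀ {m} (G : SDigraph m) r → StrongComponent G (MutuallyReachable G r)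
mutuallyReachable-strongComponent G r = strong , maximal
  where
  within : ∀ {u v} → Path G r u → Path G u v → Path G v r → PathIn G (MutuallyReachable G r) u v
  within r⇝u (here _) v⇝r = here (r⇝u , v⇝r)
  within r⇝u (step _ a p) v⇝r =
    step (r⇝u , step tt a (p ++ₚ v⇝r)) a (within (r⇝u ++ₚ step tt a (here tt)) p v⇝r)

  strong : StronglyConnected G (MutuallyReachable G r)
  strong u v (r⇝u , u⇝r) (r⇝v , v⇝r) = within r⇝u (u⇝r ++ₚ r⇝v) v⇝r

  maximal : ∀ T → (∀ v → MutuallyReachable G r v → T v) → StronglyConnected G T →
    ∀ v → T v → MutuallyReachable G r v
  maximal T ⊇ strongT v v∈T = PathIn⇒Path (strongT r v r∈T v∈T) , PathIn⇒Path (strongT v r v∈T r∈T)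
    where
    r∈T : T r
    r∈T = ⊇ r (here tt , here tt)

record Enumeration {m} (S : VSet m) : Set where
  field
    size : ℕ
    index : Fin size → Fin m
    enumerates : Enumerates index S

lookup-injective : ∀ {A : Set} {xs : List A} → Unique xs → Injective _≡_ _≡_ (List.lookup xs)
lookup-injective (_ ∷ _) {zero} {zero} _ = refl
lookup-injective (x∉xs ∷ _) {zero} {suc j} eq = ⊥-elim (All.lookup x∉xs (∈-lookup j) eq)
lookup-injective (x∉xs ∷ _) {suc i} {zero} eq = ⊥-elim (All.lookup x∉xs (∈-lookup i) (sym eq))
lookup-injective (_ ∷ xs!) {suc i} {suc j} eq = cong suc (lookup-injective xs! eq)

enumerate : ∀ {m} {S : VSet m} → Decidable S → Enumeration S
enumerate {m} {S} S? = record
  { size = length xs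
  ; index = List.lookup xs
  ; enumerates = lookup-injective (filter⁺ S? (allFin⁺ m)) , λ v → onto , into
  }
  where
  xs : List (Fin m)
  xs = filter S? (allFin m)
  onto : ∀ {v} → S v → ∃ λ a → List.lookup xs a ≡ v
  onto {v} v∈S = let v∈xs = ∈-filter⁺ S? (∈-allFin v) v∈S in Any.index v∈xs , sym (lookup-index v∈xs)
  into : ∀ {v} → ∃ (λ a → List.lookup xs a ≡ v) → S v
  into (a , refl) = proj₂ (∈-filter⁻ S? {xs = allFin m} (∈-lookup a))

open RawMonad (¬¬-Monad {0ℓ}) using (rawApplicative; _>>=_; pure)

¬¬-decidable : ∀ {n} (P : Pred (Fin n) 0ℓ) → ¬ ¬ Decidable P
¬¬-decidable P = sequence rawApplicative λ _ → ¬¬-excluded-middle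

Varies : ∀ {k} → CSet k → Config k → Fin k → Set
Varies A x₀ a = ∃ λ y → A y × lookup y a ≢ lookup x₀ a

ComponentwisePerfectlyFixing : ∀ {m} → SDigraph m → Set₁
ComponentwisePerfectlyFixing {m} G = ∀ (S : VSet m) → StrongComponent G S →
  ∀ (k : ℕ) (ι : Fin k → Fin m) → Enumerates ι S → PerfectlyFixing (Induced G ι)

-- A vertex that is G-minimal among those varying on A does not vary: upstream of its strong
-- component every vertex is frozen on A, so A projects to an attractor of a network whose
-- interaction graph lies in that (perfectly fixing) component.
module NoVariation
  {m} {G : SDigraph m} (components : ComponentwisePerfectlyFixing G)
  {k} {H : SDigraph k} {ι : Fin k → Fin m} (H⊆G : SubgraphVia H G ι)
  {f : BN k} (f∈F : InF H f) {A : CSet k} (attractor : Attractor f A) {x₀ : Config k} (x₀∈A : A x₀)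
  (reach? : ∀ u v → Dec (Path G u v)) where

  _≲_ : Rel (Fin k) 0ℓ
  a ≲ b = Path G (ι a) (ι b)

  G-arc : ∀ {a c s} → GArc f a c s → G (ι a) (ι c) s
  G-arc {a} {c} {s} arc = proj₂ H⊆G a c s (proj₂ (f∈F a c s) arc)

  module _ {i} (i-minimal : ∀ a → Varies A x₀ a → a ≲ i → i ≲ a) where

    T : VSet m
    T = MutuallyReachable G (ι i)

    T? : Decidable T
    T? u = reach? (ι i) u ×-dec reach? u (ι i)

    open Enumeration (enumerate T?)
      renaming (size to t; index to ιT; enumerates to ιT-enumerates)
    open Enumeration (enumerate (T? ∘ ι))
      renaming (size to p; index to e; enumerates to e-enumerates)
    open Restriction f x₀ e (proj₁ e-enumerates)

    image-T : ∀ {c} → InImage c → T (ι c)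
    image-T = proj₂ (proj₂ e-enumerates _)

    T-image : ∀ {c} → T (ι c) → InImage c
    T-image = proj₁ (proj₂ e-enumerates _)

    upstream-frozen : ∀ a q → ¬ InImage a → UArc (GArc f) a (e q) →
      ∀ y → A y → lookup y a ≡ lookup x₀ a
    upstream-frozen a q ∉image (s , arc) y y∈A = decidable-stable (_ ≟ᵇ _) λ d →
      ∉image (T-image (i-minimal a (y , y∈A , d) a≲i , a≲i))
      where
      a≲i : a ≲ i
      a≲i = step tt (s , G-arc arc) (proj₂ (image-T (q , refl)))

    κ-spec : ∀ q → ∃ λ r → ιT r ≡ ι (e q)
    κ-spec q = proj₁ (proj₂ ιT-enumerates (ι (e q))) (image-T (q , refl))

    κ : Fin p → Fin t
    κ = proj₁ ∘ κ-spec

    restrict-subgraph : SubgraphVia (GArc restrict) (Induced G ιT) κ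
    restrict-subgraph = κ-injective , λ q q′ s arc →
      subst₂ (λ u v → G u v s) (sym (proj₂ (κ-spec q))) (sym (proj₂ (κ-spec q′)))
        (G-arc (restrict-arc arc))
      where
      κ-injective : Injective _≡_ _≡_ κ
      κ-injective {q} {q′} κq≡κq′ = proj₁ e-enumerates (proj₁ H⊆G
        (trans (sym (proj₂ (κ-spec q))) (trans (cong ιT κq≡κq′) (proj₂ (κ-spec q′)))))

    projected-singleton : SizeOne (Projected attractor upstream-frozen)
    projected-singleton =
      components T (mutuallyReachable-strongComponent G (ι i)) t ιT ιT-enumerates
        p (GArc restrict) κ restrict-subgraph
        restrict (λ _ _ _ → id , id) _ (Projected-attractor attractor upstream-frozen)

    project-constant : ∀ {y} → A y → project y ≡ project x₀
    project-constant {y} y∈A =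
      trans (unique (project y) (y , y∈A , refl)) (sym (unique (project x₀) (x₀ , x₀∈A , refl)))
      where
      unique : ∀ z → Projected attractor upstream-frozen z → z ≡ proj₁ projected-singleton
      unique = proj₂ (proj₂ projected-singleton)

    not-varies : ¬ Varies A x₀ i
    not-varies (y , y∈A , y≢x₀) with T-image {i} (here tt , here tt)
    ... | q , eq = y≢x₀ (begin
      lookup y i              ≡⟨ cong (lookup y) eq ⟨
      lookup y (e q)          ≡⟨ lookup-project y q ⟨
      lookup (project y) q    ≡⟨ cong (λ w → lookup w q) (project-constant y∈A) ⟩
      lookup (project x₀) q   ≡⟨ lookup-project x₀ q ⟩
      lookup x₀ (e q)         ≡⟨ cong (lookup x₀) eq ⟩
      lookup x₀ i             ∎)
      where open ≡-Reasoning

  no-variation : Decidable (Varies A x₀) → ∀ a → ¬ Varies A x₀ a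
  no-variation varies? a a-varies =
    let i , i-varies , i-minimal =
          Minimal.minimal varies? (λ a b → reach? (ι a) (ι b)) (here tt) _++ₚ_ a-varies
    in not-varies i-minimal i-varies

lemma22 : ∀ (m : ℕ) (G : SDigraph m)
    → (∀ (S : VSet m) → StrongComponent G S
        → ∀ (k : ℕ) (ι : Fin k → Fin m) → Enumerates ι S
        → PerfectlyFixing (Induced G ι))
    → PerfectlyFixing G
lemma22 m G components k H ι H⊆G f f∈F A attractor =
  x₀ , x₀∈A , λ y y∈A → decidable-stable (≡-dec _≟ᵇ_ y x₀) (¬¬-constant y∈A)
  where
  x₀ : Config k
  x₀ = proj₁ (proj₁ attractor)
  x₀∈A : A x₀
  x₀∈A = proj₂ (proj₁ attractor)
  -- Reachability in G and variation on A need not be decidable, but y ≡ x₀ is, so we may assume both.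
  ¬¬-constant : ∀ {y} → A y → ¬ ¬ (y ≡ x₀)
  ¬¬-constant {y} y∈A = do
    reach? ← sequence rawApplicative λ u → ¬¬-decidable (Path G u)
    varies? ← ¬¬-decidable (Varies A x₀)
    let open NoVariation components H⊆G f∈F attractor x₀∈A reach?
    pure (lookup-ext λ a → decidable-stable (_ ≟ᵇ _) λ d → no-variation varies? a (y , y∈A , d))
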